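{- Let $S$ be an excluded $3$-minor for the class of vf-safe delta-matroids. Then $S$ has a twisted dual that is isomorphic to a set system in $\mathcal S\cup\mathcal T$.
   Context: A set system is a pair $S=(E,\mathcal F)$ where $E$ is a finite set and $\mathcal F$ is a collection of subsets of $E$ (the feasible sets); $S$ is proper if $\mathcal F\neq\emptyset$. Two set systems are isomorphic if some bijection between their ground sets maps the feasible sets of one onto those of the other. A delta-matroid is a proper set system such that for all $X,Y\in\mathcal F$ and all $u\in X\triangle Y$ there is $v\in X\triangle Y$ (possibly $v=u$) with $X\triangle\{u,v\}\in\mathcal F$. For $e\in E$: $e$ is a loop if it lies in no feasible set, and a coloop if it lies in every feasible set. If $e$ is not a loop, $S/e=(E-e,\{F-e: e\in F\in\mathcal F\})$; if $e$ is not a coloop, $S\setminus e=(E-e,\{F\in\mathcal F: e\notin F\})$; if $e$ is a loop or a coloop, whichever of $S/e$, $S\setminus e$ is undefined is set equal to the other. For $A\subseteq E$, the twist is $S*A=(E,\{F\triangle A: F\in\mathcal F\})$, and the loop complementation $S+A$ is the set system on $E$ in which $F$ is feasible iff $S$ has an odd number of feasible sets $F'$ with $F-A\subseteq F'\subseteq F$. A twisted dual of $S$ is any set system obtained from $S$ by a finite sequence of twists and loop complementations. The Penrose contraction is $S\ddagger e=(S+\{e\})/e$. A $3$-minor of $S$ is any set system obtained from $S$ by a finite (possibly empty) sequence of single-element deletions, contractions and Penrose contractions. A delta-matroid is vf-safe if all of its twisted duals are delta-matroids. A proper set system $S$ is an excluded $3$-minor for the class of vf-safe delta-matroids if $S$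 is not a vf-safe delta-matroid but every $3$-minor of $S$ other than $S$ itself is a vf-safe delta-matroid. For $i\ge 3$ let $S_i=(\{e_1,\dots,e_i\},\{\emptyset,\{e_1,\dots,e_i\}\})$, and let $\mathcal S$ be the set of all twists of $S_3,S_4,\dots$. Let $T_1=(\{a,b,c\},\{\emptyset,\{a,b\},\{a,b,c\}\})$, $T_2=(\{a,b,c\},\{\emptyset,\{a,b\},\{a,c\},\{a,b,c\}\})$, $T_3=(\{a,b,c\},\{\emptyset,\{a\},\{a,b\},\{a,b,c\}\})$, $T_4=(\{a,b,c\},\{\emptyset,\{a\},\{a,b\},\{a,c\},\{a,b,c\}\})$, $T_5=(\{a,b,c,d\},\{\emptyset,\{a,b\},\{a,b,c,d\}\})$, $T_6=(\{a,b,c,d\},\{\emptyset,\{a,b\},\{a,c\},\{a,b,c,d\}\})$, $T_7=(\{a,b,c,d\},\{\emptyset,\{a,b\},\{a,c\},\{a,d\},\{a,b,c,d\}\})$, $T_8=(\{a,b,c,d\},\{\emptyset,\{a\},\{a,b\},\{a,c\},\{a,d\},\{a,b,c,d\}\})$, and let $\mathcal T$ be the set of all twists of $T_1,\dots,T_8$. -}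

module Defs where

open import Data.Bool using (Bool; true; false; not; _∧_; _∨_; _xor_; if_then_else_)
open import Data.Nat using (ℕ; zero; suc; _≤_; _<_)
open import Data.Fin using (Fin; zero; suc)
open import Data.Fin.Subset using (Subset; ⊥; ⊤; ⁅_⁆; _∪_; _∈_; _─_)
open import Data.Vec using (Vec; []; _∷_; insertAt; lookup; tabulate; zipWith)
import Data.Vec.Properties as VP
import Data.Bool.Properties as BP
open import Data.List using (List; []; _∷_; _++_; map; foldr; filterᵇ)
open import Data.Bool.ListAction using (any)
open import Data.Product using (Σ; Σ-syntax; ∃; _×_; _,_)
open import Data.Sum using (_⊎_)
open import Relation.Binary.PropositionalEquality using (_≡_)
open import Relation.Nullary using (¬_; does)
open import Function.Bundles using (_↔_; Inverse)

-- Set systems on the ground set Fin n.  A subset of Fin n is a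
-- 'Subset n' (= Vec Bool n, true = inside).  The collection of feasible
-- sets is given by its characteristic function.

SetSystem : ℕ → Set
SetSystem n = Subset n → Bool

Feasible : ∀ {n} → SetSystem n → Subset n → Set
Feasible S X = S X ≡ true

allSubsets : (n : ℕ) → List (Subset n)
allSubsets zero    = [] ∷ []
allSubsets (suc n) = map (false ∷_) (allSubsets n) ++ map (true ∷_) (allSubsets n)

_=ˢ_ : ∀ {n} → Subset n → Subset n → Bool
X =ˢ Y = does (VP.≡-dec BP._≟_ X Y)

_⊆ᵇ_ : ∀ {n} → Subset n → Subset n → Bool
[] ⊆ᵇ [] = true
(x ∷ xs) ⊆ᵇ (y ∷ ys) = (not x ∨ y) ∧ (xs ⊆ᵇ ys)

_△_ : ∀ {n} → Subset n → Subset n → Subset n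
X △ Y = zipWith _xor_ X Y

Proper : ∀ {n} → SetSystem n → Set
Proper S = ∃ λ X → Feasible S X

inSomeFeasible : ∀ {n} → SetSystem (suc n) → Fin (suc n) → Bool
inSomeFeasible {n} S e = any (λ X → S (insertAt X e true)) (allSubsets n)

outOfSomeFeasible : ∀ {n} → SetSystem (suc n) → Fin (suc n) → Bool
outOfSomeFeasible {n} S e = any (λ X → S (insertAt X e false)) (allSubsets n)

-- e is a loop iff not inSomeFeasible; a coloop iff not outOfSomeFeasible.
-- If e is a loop: S/e := S\e.  (If e is both, S has no feasible sets and
-- both operations give the empty collection.)
contract : ∀ {n} → Fin (suc n) → SetSystem (suc n) → SetSystem n
contract e S X =
  if inSomeFeasible S e then S (insertAt X e true) else S (insertAt X e false)

delete : ∀ {n} → Fin (suc n) → SetSystem (suc n) → SetSystem n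
delete e S X =
  if outOfSomeFeasible S e then S (insertAt X e false) else S (insertAt X e true)

twist : ∀ {n} → Subset n → SetSystem n → SetSystem n
twist A S X = S (X △ A)

loopCompl : ∀ {n} → Subset n → SetSystem n → SetSystem n
loopCompl {n} A S X =
  foldr _xor_ false
    (map S (filterᵇ (λ Y → ((X ─ A) ⊆ᵇ Y) ∧ (Y ⊆ᵇ X)) (allSubsets n)))

penrose : ∀ {n} → Fin (suc n) → SetSystem (suc n) → SetSystem n
penrose e S = contract e (loopCompl ⁅ e ⁆ S)

data TwistedDual {n} (S : SetSystem n) : SetSystem n → Set where
  td-refl  : TwistedDual S S
  td-twist : ∀ {T} → TwistedDual S T → (A : Subset n) → TwistedDual S (twist A T)
  td-loop  : ∀ {T} → TwistedDual S T → (A : Subset n) → TwistedDual S (loopCompl A T)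

data ThreeMinor {n} (S : SetSystem n) : ∀ {m} → SetSystem m → Set where
  tm-refl : ThreeMinor S S
  tm-del  : ∀ {m} {T : SetSystem (suc m)} → ThreeMinor S T → (e : Fin (suc m)) →
            ThreeMinor S (delete e T)
  tm-con  : ∀ {m} {T : SetSystem (suc m)} → ThreeMinor S T → (e : Fin (suc m)) →
            ThreeMinor S (contract e T)
  tm-pen  : ∀ {m} {T : SetSystem (suc m)} → ThreeMinor S T → (e : Fin (suc m)) →
            ThreeMinor S (penrose e T)

-- 3-minors obtained by a nonempty sequence (exactly the 3-minors other
-- than S itself, since each step removes one element)
data ProperThreeMinor {n} (S : SetSystem (suc n)) {m} (T : SetSystem m) : Set where
  ptm-del : (e : Fin (suc n)) → ThreeMinor (delete e S) T → ProperThreeMinor S T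
  ptm-con : (e : Fin (suc n)) → ThreeMinor (contract e S) T → ProperThreeMinor S T
  ptm-pen : (e : Fin (suc n)) → ThreeMinor (penrose e S) T → ProperThreeMinor S T

DeltaMatroid : ∀ {n} → SetSystem n → Set
DeltaMatroid {n} S =
  Proper S ×
  (∀ (X Y : Subset n) → Feasible S X → Feasible S Y →
     ∀ (u : Fin n) → u ∈ (X △ Y) →
       Σ[ v ∈ Fin n ] (v ∈ (X △ Y) × Feasible S (X △ (⁅ u ⁆ ∪ ⁅ v ⁆))))

VfSafe : ∀ {n} → SetSystem n → Set
VfSafe S = DeltaMatroid S × (∀ T → TwistedDual S T → DeltaMatroid T)

-- S is an excluded 3-minor (ground set of size n; size 0 admits no
-- proper 3-minor, handled by ProperThreeMinor being defined for suc n
-- and the separate case below)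
ExcludedThreeMinor : ∀ {n} → SetSystem n → Set
ExcludedThreeMinor {zero} S = Proper S × ¬ VfSafe S
ExcludedThreeMinor {suc n} S =
  Proper S × ¬ VfSafe S ×
  (∀ {m} (T : SetSystem m) → ProperThreeMinor S T → VfSafe T)

image : ∀ {n m} → Fin n ↔ Fin m → Subset n → Subset m
image σ X = tabulate (λ j → lookup X (Inverse.from σ j))

Isomorphic : ∀ {n m} → SetSystem n → SetSystem m → Set
Isomorphic {n} {m} S R = Σ[ σ ∈ Fin n ↔ Fin m ] (∀ X → R (image σ X) ≡ S X)

memb : ∀ {n} → List (Subset n) → SetSystem n
memb L X = any (X =ˢ_) L

Sfam : (i : ℕ) → SetSystem i
Sfam i = memb (⊥ ∷ ⊤ ∷ [])

-- a = 0, b = 1, c = 2, d = 3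
private
  t f : Bool
  t = true
  f = false

T₁ T₂ T₃ T₄ : SetSystem 3
T₁ = memb ((f ∷ f ∷ f ∷ []) ∷ (t ∷ t ∷ f ∷ []) ∷ (t ∷ t ∷ t ∷ []) ∷ [])
T₂ = memb ((f ∷ f ∷ f ∷ []) ∷ (t ∷ t ∷ f ∷ []) ∷ (t ∷ f ∷ t ∷ []) ∷ (t ∷ t ∷ t ∷ []) ∷ [])
T₃ = memb ((f ∷ f ∷ f ∷ []) ∷ (t ∷ f ∷ f ∷ []) ∷ (t ∷ t ∷ f ∷ []) ∷ (t ∷ t ∷ t ∷ []) ∷ [])
T₄ = memb ((f ∷ f ∷ f ∷ []) ∷ (t ∷ f ∷ f ∷ []) ∷ (t ∷ t ∷ f ∷ []) ∷ (t ∷ f ∷ t ∷ [])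
           ∷ (t ∷ t ∷ t ∷ []) ∷ [])

T₅ T₆ T₇ T₈ : SetSystem 4
T₅ = memb ((f ∷ f ∷ f ∷ f ∷ []) ∷ (t ∷ t ∷ f ∷ f ∷ []) ∷ (t ∷ t ∷ t ∷ t ∷ []) ∷ [])
T₆ = memb ((f ∷ f ∷ f ∷ f ∷ []) ∷ (t ∷ t ∷ f ∷ f ∷ []) ∷ (t ∷ f ∷ t ∷ f ∷ [])
           ∷ (t ∷ t ∷ t ∷ t ∷ []) ∷ [])
T₇ = memb ((f ∷ f ∷ f ∷ f ∷ []) ∷ (t ∷ t ∷ f ∷ f ∷ []) ∷ (t ∷ f ∷ t ∷ f ∷ [])
           ∷ (t ∷ f ∷ f ∷ t ∷ []) ∷ (t ∷ t ∷ t ∷ t ∷ []) ∷ [])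
T₈ = memb ((f ∷ f ∷ f ∷ f ∷ []) ∷ (t ∷ f ∷ f ∷ f ∷ []) ∷ (t ∷ t ∷ f ∷ f ∷ [])
           ∷ (t ∷ f ∷ t ∷ f ∷ []) ∷ (t ∷ f ∷ f ∷ t ∷ []) ∷ (t ∷ t ∷ t ∷ t ∷ []) ∷ [])

IsoToFamS : ∀ {n} → SetSystem n → Set
IsoToFamS R = Σ[ i ∈ ℕ ] (3 ≤ i × Σ[ A ∈ Subset i ] Isomorphic R (twist A (Sfam i)))

IsoToFamT : ∀ {n} → SetSystem n → Set
IsoToFamT R =
  (Σ[ A ∈ Subset 3 ] (Isomorphic R (twist A T₁) ⊎ Isomorphic R (twist A T₂) ⊎
                      Isomorphic R (twist A T₃) ⊎ Isomorphic R (twist A T₄))) ⊎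
  (Σ[ A ∈ Subset 4 ] (Isomorphic R (twist A T₅) ⊎ Isomorphic R (twist A T₆) ⊎
                      Isomorphic R (twist A T₇) ⊎ Isomorphic R (twist A T₈)))

module Submission where

-- A set system on n elements is a function {0,1}ⁿ → 𝔽₂, i.e. a tensor in (𝔽₂²)^⊗n.
-- Twisting and loop complementing one element act on its tensor factor by the
-- matrices τ = (0 1; 1 0) and ℓ = (1 0; 1 1), which generate GL(2, 𝔽₂) ≅ S₃.  Hence the
-- twisted duals of S are exactly the systems act M S for M ∈ GL(2, 𝔽₂)ⁿ, and deleting
-- or contracting e in act M S gives a twisted dual of a deletion, contraction or
-- Penrose contraction of S at e (rowMinor-threeMinor).
--
-- Now let S be an excluded 3-minor.  A failure of the exchange axiom for sets X, Y in
-- a twisted dual survives in the minor at any e where X and Y agree, which is vf-safe;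
-- so X and Y are complementary, and twisting by X turns the failure into one for ∅,
-- E and some u.  Such a failure forces every set containing u, except E, to be
-- infeasible; on two or fewer elements this is absurd, on four or more elements loop
-- complementing a further element produces a failure between agreeing sets, and on
-- three elements the 24 possible systems are matched, by a finite search, with twists
-- of S₃, T₁, …, T₄.

open import Defs
open import Data.Nat using (zero; suc; _+_; s≤s; z≤n)
open import Data.Product using (Σ-syntax; _×_; ∃; _,_; proj₁; proj₂)
open import Data.Sum using (_⊎_; inj₁; inj₂)
open import Data.Bool using (Bool; true; false; not; _∧_; _∨_; _xor_; if_then_else_)
import Data.Bool.Properties as BP
open import Data.Fin using (Fin; zero; suc; punchIn; punchOut; _↑ˡ_)
import Data.Fin.Properties as FP
open import Data.Fin.Subset using (Subset; ⁅_⁆; _∪_; _─_) renaming (⊥ to ∅; ⊤ to E; _∈_ to _∈ˢ_)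
import Data.Fin.Subset.Properties as SP
open import Data.Fin.Permutation using (Permutation; id; transpose; _∘ₚ_)
open import Data.Vec using (Vec; []; _∷_; head; insertAt; removeAt; lookup; zipWith; replicate; map)
import Data.Vec.Properties as VP
open import Data.List using (List; []; _∷_; _++_; foldr; filterᵇ; concatMap) renaming (map to mapᴸ)
import Data.List.Properties as LP
open import Data.List.Membership.Propositional using (_∈_)
open import Data.List.Membership.Propositional.Properties using (∈-map⁺; ∈-++⁺ˡ; ∈-++⁺ʳ)
import Data.List.Relation.Unary.All as All
import Data.List.Relation.Unary.Any as Any
open import Data.List.Relation.Unary.Any using (Any; here; satisfied)
open import Data.List.Relation.Unary.Any.Properties using (any⁺; any⁻)
open import Data.Bool.ListAction using (any; or)
open import Data.Maybe using (just; nothing)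
open import Data.Empty using (⊥-elim)
open import Relation.Binary.PropositionalEquality
open import Relation.Nullary using (¬_; Dec; yes; no)
open import Relation.Nullary.Decidable using (map′; toWitness; ¬?; _×-dec_)
open import Function using (_∘_; Equivalence; mk⇔)
open import Tactic.RingSolver using (solve-∀)
open import Tactic.RingSolver.Core.AlmostCommutativeRing using (AlmostCommutativeRing; fromCommutativeRing)
open import Level using (0ℓ)

module Enumerated {A : Set} (elems : List A) (complete : ∀ a → a ∈ elems) where

  all? : {P : A → Set} → (∀ a → Dec (P a)) → Dec (∀ a → P a)
  all? P? = map′ (λ ps a → All.lookup ps (complete a)) (λ p → All.tabulate (λ {a} _ → p a))
                 (All.all? P? elems)

  any? : {P : A → Set} → (∀ a → Dec (P a)) → Dec (∃ P)
  any? P? = map′ satisfied (λ (a , p) → Any.map (λ { refl → p }) (complete a)) (Any.any? P? elems)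

bool-complete : ∀ b → b ∈ (false ∷ true ∷ [])
bool-complete false = here refl
bool-complete true  = Any.there (here refl)

module EnumBool = Enumerated (false ∷ true ∷ []) bool-complete

true≢false : true ≢ false
true≢false ()

BoolRing : AlmostCommutativeRing 0ℓ 0ℓ
BoolRing = fromCommutativeRing BP.xor-∧-commutativeRing λ { false → just refl ; true → nothing }

-- two 2×2 matrices acting on different tensor factors commute
interchange : ∀ α β γ δ a₀ a₁ b₀ b₁ →
  (α ∧ ((γ ∧ a₀) xor (δ ∧ a₁))) xor (β ∧ ((γ ∧ b₀) xor (δ ∧ b₁))) ≡
  (γ ∧ ((α ∧ a₀) xor (β ∧ b₀))) xor (δ ∧ ((α ∧ a₁) xor (β ∧ b₁)))
interchange = solve-∀ BoolRing

-- applying two matrices in turn is applying their product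
matrix-assoc : ∀ m₀ m₁ k₀₀ k₀₁ k₁₀ k₁₁ p q →
  (m₀ ∧ ((k₀₀ ∧ p) xor (k₀₁ ∧ q))) xor (m₁ ∧ ((k₁₀ ∧ p) xor (k₁₁ ∧ q))) ≡
  (((m₀ ∧ k₀₀) xor (m₁ ∧ k₁₀)) ∧ p) xor (((m₀ ∧ k₀₁) xor (m₁ ∧ k₁₁)) ∧ q)
matrix-assoc = solve-∀ BoolRing

-- The group GL(2, 𝔽₂) of the six single-element twisted dualities

-- ι is the identity, τ the twist, ℓ the loop complementation; the other
-- three elements are named by their factorization into τ and ℓ.
data G : Set where
  ι τ ℓ ℓτ τℓ τℓτ : G

G-complete : ∀ g → g ∈ (ι ∷ τ ∷ ℓ ∷ ℓτ ∷ τℓ ∷ τℓτ ∷ [])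
G-complete ι   = here refl
G-complete τ   = Any.there (here refl)
G-complete ℓ   = Any.there (Any.there (here refl))
G-complete ℓτ  = Any.there (Any.there (Any.there (here refl)))
G-complete τℓ  = Any.there (Any.there (Any.there (Any.there (here refl))))
G-complete τℓτ = Any.there (Any.there (Any.there (Any.there (Any.there (here refl)))))

module EnumG = Enumerated (ι ∷ τ ∷ ℓ ∷ ℓτ ∷ τℓ ∷ τℓτ ∷ []) G-complete

matrix : Bool → Bool → Bool → Bool → Bool → Bool → Bool
matrix a b c d false false = a
matrix a b c d false true  = b
matrix a b c d true  false = c
matrix a b c d true  true  = d

-- ent g x y: the entry of g in row x (new membership) and column y (old membership)
ent : G → Bool → Bool → Bool
ent ι   = matrix true  false false true
ent τ   = matrix false true  true  false
ent ℓ   = matrix true  false true  true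
ent ℓτ  = matrix false true  true  true
ent τℓ  = matrix true  true  true  false
ent τℓτ = matrix true  true  false true

fromMatrix : Bool → Bool → Bool → Bool → G
fromMatrix false true  true  false = τ
fromMatrix true  false true  true  = ℓ
fromMatrix false true  true  true  = ℓτ
fromMatrix true  true  true  false = τℓ
fromMatrix true  true  false true  = τℓτ
fromMatrix _     _     _     _     = ι

product : G → G → Bool → Bool → Bool
product g h x y = (ent g x false ∧ ent h false y) xor (ent g x true ∧ ent h true y)

infixl 7 _·_
_·_ : G → G → G
g · h = fromMatrix (product g h false false) (product g h false true)
                   (product g h true false) (product g h true true)

ent-· : ∀ g h x y → ent (g · h) x y ≡ product g h x y
ent-· = toWitness {a? = EnumG.all? λ g → EnumG.all? λ h → EnumBool.all? λ x → EnumBool.all? λ y →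
                         ent (g · h) x y BP.≟ product g h x y} _

_⁻¹ : G → G
ℓτ ⁻¹ = τℓ
τℓ ⁻¹ = ℓτ
g  ⁻¹ = g

⁻¹-inverse : ∀ g → g ⁻¹ · g ≡ ι
⁻¹-inverse ι   = refl
⁻¹-inverse τ   = refl
⁻¹-inverse ℓ   = refl
⁻¹-inverse ℓτ  = refl
⁻¹-inverse τℓ  = refl
⁻¹-inverse τℓτ = refl

twistG loopG : Bool → G
twistG false = ι
twistG true  = τ
loopG false = ι
loopG true  = ℓ

outer middle inner : G → Bool
outer  ι = false ; outer  τ  = true  ; outer  ℓ  = false
outer  ℓτ = false ; outer  τℓ = true  ; outer  τℓτ = true
middle ι = false ; middle τ  = false ; middle ℓ  = true
middle ℓτ = true  ; middle τℓ = true  ; middle τℓτ = true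
inner  ι = false ; inner  τ  = false ; inner  ℓ  = false
inner  ℓτ = true  ; inner  τℓ = false ; inner  τℓτ = true

factorization : ∀ g → twistG (outer g) · (loopG (middle g) · twistG (inner g)) ≡ g
factorization ι   = refl
factorization τ   = refl
factorization ℓ   = refl
factorization ℓτ  = refl
factorization τℓ  = refl
factorization τℓτ = refl

-- The coordinatewise action of Gⁿ on set systems

slice : ∀ {n} → Fin (suc n) → Bool → SetSystem (suc n) → SetSystem n
slice e b T Y = T (insertAt Y e b)

lin : ∀ {n} → Bool → Bool → SetSystem n → SetSystem n → SetSystem n
lin α β f g Y = (α ∧ f Y) xor (β ∧ g Y)

-- Viewing a set system as a tensor in (𝔽₂²)^⊗n, the vector M acts by the
-- matrix M i on the i-th factor.
act : ∀ {n} → Vec G n → SetSystem n → SetSystem n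
act []      T X       = T X
act (g ∷ M) T (x ∷ X) =
  lin (ent g x false) (ent g x true) (act M (slice zero false T)) (act M (slice zero true T)) X

act-cong : ∀ {n} (M : Vec G n) {f g : SetSystem n} → f ≗ g → act M f ≗ act M g
act-cong []      f≗g X       = f≗g X
act-cong (m ∷ M) f≗g (x ∷ X) =
  cong₂ (λ p q → (ent m x false ∧ p) xor (ent m x true ∧ q))
        (act-cong M (f≗g ∘ (false ∷_)) X) (act-cong M (f≗g ∘ (true ∷_)) X)

act-linear : ∀ {n} (M : Vec G n) α β (f g : SetSystem n) →
  act M (lin α β f g) ≗ lin α β (act M f) (act M g)
act-linear []      α β f g X       = refl
act-linear (m ∷ M) α β f g (x ∷ X) =
  trans (cong₂ (λ p q → (ent m x false ∧ p) xor (ent m x true ∧ q))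
               (act-linear M α β _ _ X) (act-linear M α β _ _ X))
        (interchange (ent m x false) (ent m x true) α β _ _ _ _)

act-∘ : ∀ {n} (M N : Vec G n) (T : SetSystem n) → act M (act N T) ≗ act (zipWith _·_ M N) T
act-∘ []      []      T X       = refl
act-∘ (m ∷ M) (k ∷ N) T (x ∷ X) =
  begin
    (ent m x false ∧ act M (slice zero false (act (k ∷ N) T)) X) xor
    (ent m x true  ∧ act M (slice zero true (act (k ∷ N) T)) X)
  ≡⟨ cong₂ (λ p q → (ent m x false ∧ p) xor (ent m x true ∧ q)) (row false) (row true) ⟩
    (ent m x false ∧ ((ent k false false ∧ P) xor (ent k false true ∧ Q))) xor
    (ent m x true  ∧ ((ent k true false ∧ P) xor (ent k true true ∧ Q)))
  ≡⟨ matrix-assoc (ent m x false) (ent m x true) (ent k false false) (ent k false true)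
                  (ent k true false) (ent k true true) P Q ⟩
    (product m k x false ∧ P) xor (product m k x true ∧ Q)
  ≡⟨ sym (cong₂ (λ p q → (p ∧ P) xor (q ∧ Q)) (ent-· m k x false) (ent-· m k x true)) ⟩
    (ent (m · k) x false ∧ P) xor (ent (m · k) x true ∧ Q)
  ∎
  where
  open ≡-Reasoning
  P Q : Bool
  P = act (zipWith _·_ M N) (slice zero false T) X
  Q = act (zipWith _·_ M N) (slice zero true T) X
  row : ∀ y → act M (slice zero y (act (k ∷ N) T)) X ≡ (ent k y false ∧ P) xor (ent k y true ∧ Q)
  row y = trans (act-linear M (ent k y false) (ent k y true) _ _ X)
                (cong₂ (λ p q → (ent k y false ∧ p) xor (ent k y true ∧ q))
                       (act-∘ M N _ X) (act-∘ M N _ X))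

identity : ∀ n → Vec G n
identity n = replicate n ι

act-identity : ∀ {n} (T : SetSystem n) → act (identity n) T ≗ T
act-identity T []          = refl
act-identity T (false ∷ X) = trans (BP.xor-identityʳ _) (act-identity (slice zero false T) X)
act-identity T (true ∷ X)  = act-identity (slice zero true T) X

act-inverse : ∀ {n} (M : Vec G n) (T : SetSystem n) → act (map _⁻¹ M) (act M T) ≗ T
act-inverse M T X =
  trans (act-∘ (map _⁻¹ M) M T X)
        (trans (cong (λ V → act V T X) (inverses M)) (act-identity T X))
  where
  inverses : ∀ {k} (M : Vec G k) → zipWith _·_ (map _⁻¹ M) M ≡ identity k
  inverses []      = refl
  inverses (m ∷ M) = cong₂ _∷_ (⁻¹-inverse m) (inverses M)

act-empty : ∀ {n} (M : Vec G n) → act M (λ _ → false) ≗ (λ _ → false)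
act-empty []      X       = refl
act-empty (m ∷ M) (x ∷ X) =
  trans (cong₂ (λ p q → (ent m x false ∧ p) xor (ent m x true ∧ q)) (act-empty M X) (act-empty M X))
        (cong₂ _xor_ (BP.∧-zeroʳ (ent m x false)) (BP.∧-zeroʳ (ent m x true)))

∈-allSubsets : ∀ {n} (X : Subset n) → X ∈ allSubsets n
∈-allSubsets []          = here refl
∈-allSubsets (false ∷ X) = ∈-++⁺ˡ (∈-map⁺ (false ∷_) (∈-allSubsets X))
∈-allSubsets (true ∷ X)  = ∈-++⁺ʳ _ (∈-map⁺ (true ∷_) (∈-allSubsets X))

module EnumSubset {n} = Enumerated (allSubsets n) ∈-allSubsets

nonempty : ∀ {n} → SetSystem n → Bool
nonempty {n} T = any T (allSubsets n)

nonempty-intro : ∀ {n} (T : SetSystem n) X → T X ≡ true → nonempty T ≡ true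
nonempty-intro T X TX = Equivalence.to BP.T-≡
  (any⁺ T (Any.map (λ { refl → Equivalence.from BP.T-≡ TX }) (∈-allSubsets X)))

nonempty-elim : ∀ {n} (T : SetSystem n) → nonempty T ≡ true → Proper T
nonempty-elim {n} T ne with satisfied (any⁻ T (allSubsets n) (Equivalence.from BP.T-≡ ne))
... | X , TX = X , Equivalence.to BP.T-≡ TX

nonempty-false : ∀ {n} (T : SetSystem n) → nonempty T ≡ false → ∀ X → T X ≡ false
nonempty-false T empty X with T X in TX
... | false = refl
... | true  = sym (trans (sym empty) (nonempty-intro T X TX))

nonempty-cong : ∀ {n} {f g : SetSystem n} → f ≗ g → nonempty f ≡ nonempty g
nonempty-cong {n} f≗g = cong or (LP.map-cong f≗g (allSubsets n))

-- a feasible set of T yields one of act M T, since T is recovered by M⁻¹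
act-nonempty : ∀ {n} (M : Vec G n) (T : SetSystem n) → nonempty T ≡ true → nonempty (act M T) ≡ true
act-nonempty M T ne with nonempty (act M T) in ne′
... | true  = refl
... | false = ⊥-elim (true≢false (begin
      true                          ≡⟨ sym TX ⟩
      T X                           ≡⟨ sym (act-inverse M T X) ⟩
      act (map _⁻¹ M) (act M T) X   ≡⟨ act-cong (map _⁻¹ M) (nonempty-false (act M T) ne′) X ⟩
      act (map _⁻¹ M) (λ _ → false) X ≡⟨ act-empty (map _⁻¹ M) X ⟩
      false                         ∎))
  where
  open ≡-Reasoning
  X : Subset _
  X = proj₁ (nonempty-elim T ne)
  TX : T X ≡ true
  TX = proj₂ (nonempty-elim T ne)

nonempty-act : ∀ {n} (M : Vec G n) (T : SetSystem n) → nonempty (act M T) ≡ nonempty T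
nonempty-act M T = BP.⇔→≡ {z = true} (mk⇔
  (λ ne → trans (sym (nonempty-cong (act-inverse M T))) (act-nonempty (map _⁻¹ M) (act M T) ne))
  (act-nonempty M T))

twist-act : ∀ {n} (A : Subset n) (T : SetSystem n) → twist A T ≗ act (map twistG A) T
twist-act []          T []          = refl
twist-act (false ∷ A) T (false ∷ X) = trans (twist-act A (slice zero false T) X) (sym (BP.xor-identityʳ _))
twist-act (false ∷ A) T (true ∷ X)  = twist-act A (slice zero true T) X
twist-act (true ∷ A)  T (false ∷ X) = twist-act A (slice zero true T) X
twist-act (true ∷ A)  T (true ∷ X)  = trans (twist-act A (slice zero false T) X) (sym (BP.xor-identityʳ _))

parity : List Bool → Bool
parity = foldr _xor_ false

parity-++ : ∀ l₁ l₂ → parity (l₁ ++ l₂) ≡ parity l₁ xor parity l₂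
parity-++ []       l₂ = refl
parity-++ (b ∷ l₁) l₂ = trans (cong (b xor_) (parity-++ l₁ l₂)) (sym (BP.xor-assoc b _ _))

filterᵇ-map : ∀ {A B : Set} (p : B → Bool) (f : A → B) l →
  filterᵇ p (mapᴸ f l) ≡ mapᴸ f (filterᵇ (p ∘ f) l)
filterᵇ-map p f []      = refl
filterᵇ-map p f (x ∷ l) with p (f x)
... | true  = cong (f x ∷_) (filterᵇ-map p f l)
... | false = filterᵇ-map p f l

filterᵇ-cong : ∀ {A : Set} {p q : A → Bool} → p ≗ q → filterᵇ p ≗ filterᵇ q
filterᵇ-cong             p≗q []      = refl
filterᵇ-cong {p = p} {q} p≗q (x ∷ l) with p x | q x | p≗q x
... | true  | true  | refl = cong (x ∷_) (filterᵇ-cong p≗q l)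
... | false | false | refl = filterᵇ-cong p≗q l

parity-split : ∀ {n} (T : SetSystem (suc n)) (P : Subset (suc n) → Bool) →
  parity (mapᴸ T (filterᵇ P (allSubsets (suc n)))) ≡
  parity (mapᴸ (slice zero false T) (filterᵇ (P ∘ (false ∷_)) (allSubsets n))) xor
  parity (mapᴸ (slice zero true T) (filterᵇ (P ∘ (true ∷_)) (allSubsets n)))
parity-split {n} T P =
  begin
    parity (mapᴸ T (filterᵇ P (mapᴸ (false ∷_) L ++ mapᴸ (true ∷_) L)))
  ≡⟨ cong (parity ∘ mapᴸ T) (LP.filter-++ _ (mapᴸ (false ∷_) L) (mapᴸ (true ∷_) L)) ⟩
    parity (mapᴸ T (filterᵇ P (mapᴸ (false ∷_) L) ++ filterᵇ P (mapᴸ (true ∷_) L)))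
  ≡⟨ cong parity (LP.map-++ T (filterᵇ P (mapᴸ (false ∷_) L)) _) ⟩
    parity (mapᴸ T (filterᵇ P (mapᴸ (false ∷_) L)) ++ mapᴸ T (filterᵇ P (mapᴸ (true ∷_) L)))
  ≡⟨ parity-++ (mapᴸ T (filterᵇ P (mapᴸ (false ∷_) L))) _ ⟩
    parity (mapᴸ T (filterᵇ P (mapᴸ (false ∷_) L))) xor parity (mapᴸ T (filterᵇ P (mapᴸ (true ∷_) L)))
  ≡⟨ cong₂ _xor_ (half false) (half true) ⟩
    parity (mapᴸ (slice zero false T) (filterᵇ (P ∘ (false ∷_)) L)) xor
    parity (mapᴸ (slice zero true T) (filterᵇ (P ∘ (true ∷_)) L))
  ∎
  where
  open ≡-Reasoning
  L : List (Subset n)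
  L = allSubsets n
  half : ∀ b → parity (mapᴸ T (filterᵇ P (mapᴸ (b ∷_) L))) ≡
               parity (mapᴸ (slice zero b T) (filterᵇ (P ∘ (b ∷_)) L))
  half b = cong parity (trans (cong (mapᴸ T) (filterᵇ-map P (b ∷_) L))
                              (sym (LP.map-∘ (filterᵇ (P ∘ (b ∷_)) L))))

parity-guard : ∀ {n} (f : SetSystem n) c (P : Subset n → Bool) L →
  parity (mapᴸ f (filterᵇ (λ Y → c ∧ P Y) L)) ≡ c ∧ parity (mapᴸ f (filterᵇ P L))
parity-guard f true  P L = refl
parity-guard f false P L = cong (parity ∘ mapᴸ f) (nothing-passes L)
  where
  nothing-passes : ∀ L → filterᵇ (λ _ → false) L ≡ []
  nothing-passes []      = refl
  nothing-passes (_ ∷ L) = nothing-passes L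

-- the membership condition of loopCompl on the first element is the matrix of ℓᵃ
loop-guard : ∀ {n} a x (A X : Subset n) y →
  (not (head ((x ∷ X) ─ (a ∷ A))) ∨ y) ∧ (not y ∨ x) ≡ ent (loopG a) x y
loop-guard false false A X false = refl
loop-guard false false A X true  = refl
loop-guard false true  A X false = refl
loop-guard false true  A X true  = refl
loop-guard true  false A X false = refl
loop-guard true  false A X true  = refl
loop-guard true  true  A X false = refl
loop-guard true  true  A X true  = refl

∧-interchange : ∀ a b c d → (a ∧ b) ∧ (c ∧ d) ≡ (a ∧ c) ∧ (b ∧ d)
∧-interchange = solve-∀ BoolRing

loopCompl-act : ∀ {n} (A : Subset n) (T : SetSystem n) → loopCompl A T ≗ act (map loopG A) T
loopCompl-act []      T []      = BP.xor-identityʳ _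
loopCompl-act (a ∷ A) T (x ∷ X) =
  begin
    loopCompl (a ∷ A) T (x ∷ X)
  ≡⟨ parity-split T _ ⟩
    parity (mapᴸ (slice zero false T) (filterᵇ (Inside false) L)) xor
    parity (mapᴸ (slice zero true T) (filterᵇ (Inside true) L))
  ≡⟨ cong₂ _xor_ (guarded false) (guarded true) ⟩
    (ent (loopG a) x false ∧ loopCompl A (slice zero false T) X) xor
    (ent (loopG a) x true ∧ loopCompl A (slice zero true T) X)
  ≡⟨ cong₂ (λ p q → (ent (loopG a) x false ∧ p) xor (ent (loopG a) x true ∧ q))
           (loopCompl-act A (slice zero false T) X) (loopCompl-act A (slice zero true T) X) ⟩
    act (map loopG (a ∷ A)) T (x ∷ X)
  ∎
  where
  open ≡-Reasoning
  L : List (Subset _)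
  L = allSubsets _
  Inside : Bool → Subset _ → Bool
  Inside y Y = (((x ∷ X) ─ (a ∷ A)) ⊆ᵇ (y ∷ Y)) ∧ ((y ∷ Y) ⊆ᵇ (x ∷ X))
  guarded : ∀ y → parity (mapᴸ (slice zero y T) (filterᵇ (Inside y) L)) ≡
                  ent (loopG a) x y ∧ loopCompl A (slice zero y T) X
  guarded y =
    trans (cong (parity ∘ mapᴸ (slice zero y T))
                (filterᵇ-cong (λ Y → trans (∧-interchange (not (head ((x ∷ X) ─ (a ∷ A))) ∨ y)
                                                          ((X ─ A) ⊆ᵇ Y) (not y ∨ x) (Y ⊆ᵇ X))
                                       (cong (_∧ ((X ─ A) ⊆ᵇ Y ∧ Y ⊆ᵇ X)) (loop-guard a x A X y))) L))
          (parity-guard (slice zero y T) (ent (loopG a) x y) (λ Y → (X ─ A) ⊆ᵇ Y ∧ Y ⊆ᵇ X) L)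

-- Twisted duals are exactly the action of Gⁿ

-- the twisted dual τ^a ℓ^b τ^c S realising M via the factorization of each M i
realise : ∀ {n} → Vec G n → SetSystem n → SetSystem n
realise M S = twist (map outer M) (loopCompl (map middle M) (twist (map inner M) S))

realise-twistedDual : ∀ {n} (M : Vec G n) (S : SetSystem n) → TwistedDual S (realise M S)
realise-twistedDual M S = td-twist (td-loop (td-twist td-refl (map inner M)) (map middle M)) (map outer M)

realise-act : ∀ {n} (M : Vec G n) (S : SetSystem n) → realise M S ≗ act M S
realise-act M S X =
  begin
    realise M S X
  ≡⟨ twist-act (map outer M) _ X ⟩
    act (map twistG (map outer M)) (loopCompl (map middle M) (twist (map inner M) S)) X
  ≡⟨ act-cong (map twistG (map outer M)) (λ Y →
       trans (loopCompl-act (map middle M) _ Y)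
             (trans (act-cong (map loopG (map middle M)) (twist-act (map inner M) S) Y)
                    (act-∘ (map loopG (map middle M)) (map twistG (map inner M)) S Y))) X ⟩
    act (map twistG (map outer M)) (act (zipWith _·_ (map loopG (map middle M)) (map twistG (map inner M))) S) X
  ≡⟨ act-∘ (map twistG (map outer M)) _ S X ⟩
    act (zipWith _·_ (map twistG (map outer M))
                     (zipWith _·_ (map loopG (map middle M)) (map twistG (map inner M)))) S X
  ≡⟨ cong (λ V → act V S X) (factorizations M) ⟩
    act M S X
  ∎
  where
  open ≡-Reasoning
  factorizations : ∀ {k} (M : Vec G k) →
    zipWith _·_ (map twistG (map outer M)) (zipWith _·_ (map loopG (map middle M)) (map twistG (map inner M))) ≡ M
  factorizations []      = refl
  factorizations (m ∷ M) = cong₂ _∷_ (factorization m) (factorizations M)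

twistedDual-act : ∀ {n} {S T : SetSystem n} → TwistedDual S T → Σ[ M ∈ Vec G n ] (T ≗ act M S)
twistedDual-act {n} {S} td-refl = identity n , λ X → sym (act-identity S X)
twistedDual-act {S = S} (td-twist S→T A) with twistedDual-act S→T
... | M , T≗MS = zipWith _·_ (map twistG A) M , λ X →
  trans (T≗MS (X △ A)) (trans (twist-act A (act M S) X) (act-∘ (map twistG A) M S X))
twistedDual-act {S = S} (td-loop {T} S→T A) with twistedDual-act S→T
... | M , T≗MS = zipWith _·_ (map loopG A) M , λ X →
  trans (loopCompl-act A T X) (trans (act-cong (map loopG A) T≗MS X) (act-∘ (map loopG A) M S X))

∈⇒lookup : ∀ {n} {x : Fin n} {p : Subset n} → x ∈ˢ p → lookup p x ≡ true
∈⇒lookup = VP.[]=⇒lookup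

lookup⇒∈ : ∀ {n} {x : Fin n} {p : Subset n} → lookup p x ≡ true → x ∈ˢ p
lookup⇒∈ {x = x} {p} = VP.lookup⇒[]= x p

lookup-△ : ∀ {n} (X Y : Subset n) i → lookup (X △ Y) i ≡ lookup X i xor lookup Y i
lookup-△ X Y i = VP.lookup-zipWith _xor_ i X Y

lookup-∪ : ∀ {n} (X Y : Subset n) i → lookup (X ∪ Y) i ≡ lookup X i ∨ lookup Y i
lookup-∪ X Y i = VP.lookup-zipWith _∨_ i X Y

lookup-∅ : ∀ {n} (i : Fin n) → lookup ∅ i ≡ false
lookup-∅ i = VP.lookup-replicate i false

lookup-E : ∀ {n} (i : Fin n) → lookup E i ≡ true
lookup-E i = VP.lookup-replicate i true

lookup-⁅⁆-≡ : ∀ {n} (a : Fin n) → lookup ⁅ a ⁆ a ≡ true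
lookup-⁅⁆-≡ a = ∈⇒lookup (SP.x∈⁅x⁆ a)

lookup-⁅⁆-≢ : ∀ {n} {a i : Fin n} → a ≢ i → lookup ⁅ a ⁆ i ≡ false
lookup-⁅⁆-≢ {a = a} {i} a≢i with lookup ⁅ a ⁆ i in eq
... | false = refl
... | true  = ⊥-elim (a≢i (sym (SP.x∈⁅y⁆⇒x≡y a (lookup⇒∈ eq))))

subset-ext : ∀ {n} (X Y : Subset n) → (∀ i → lookup X i ≡ lookup Y i) → X ≡ Y
subset-ext []      []      _  = refl
subset-ext (x ∷ X) (y ∷ Y) eq = cong₂ _∷_ (eq zero) (subset-ext X Y (eq ∘ suc))

∅-△ : ∀ {n} (W : Subset n) → ∅ △ W ≡ W
∅-△ []      = refl
∅-△ (w ∷ W) = cong (w ∷_) (∅-△ W)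

△-comm : ∀ {n} (X Y : Subset n) → X △ Y ≡ Y △ X
△-comm []      []      = refl
△-comm (x ∷ X) (y ∷ Y) = cong₂ _∷_ (BP.xor-comm x y) (△-comm X Y)

△-cancel : ∀ {n} (A X : Subset n) → (A △ X) △ A ≡ X
△-cancel []      []      = refl
△-cancel (a ∷ A) (x ∷ X) = cong₂ _∷_ (trans (BP.xor-comm (a xor x) a)
                                           (trans (sym (BP.xor-assoc a a x)) (cong (_xor x) (BP.xor-same a))))
                                     (△-cancel A X)

△-self : ∀ {n} (X : Subset n) → X △ X ≡ ∅
△-self []      = refl
△-self (x ∷ X) = cong₂ _∷_ (BP.xor-same x) (△-self X)

zipWith-insertAt : ∀ {A B C : Set} {n} (f : A → B → C) (xs : Vec A n) (ys : Vec B n) e a c →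
  zipWith f (insertAt xs e a) (insertAt ys e c) ≡ insertAt (zipWith f xs ys) e (f a c)
zipWith-insertAt f xs       ys       zero    a c = refl
zipWith-insertAt f (x ∷ xs) (y ∷ ys) (suc e) a c = cong (f x y ∷_) (zipWith-insertAt f xs ys e a c)

insertAt-∅ : ∀ {n} (e : Fin (suc n)) → insertAt (∅ {n}) e false ≡ ∅
insertAt-∅ zero            = refl
insertAt-∅ {suc n} (suc e) = cong (false ∷_) (insertAt-∅ e)

insertAt-E : ∀ {n} (e : Fin (suc n)) → insertAt (E {n}) e true ≡ E
insertAt-E zero            = refl
insertAt-E {suc n} (suc e) = cong (true ∷_) (insertAt-E e)

split-at : ∀ {n} (X : Subset (suc n)) u {b Z} → lookup X u ≡ b → removeAt X u ≡ Z → X ≡ insertAt Z u b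
split-at X u refl refl = sym (VP.insertAt-removeAt X u)

lookup-punchIn : ∀ {n} (X : Subset (suc n)) u {b Z} → lookup X u ≡ b → removeAt X u ≡ Z →
  ∀ j → lookup X (punchIn u j) ≡ lookup Z j
lookup-punchIn X u {b} {Z} Xu X′ j =
  trans (cong (λ V → lookup V (punchIn u j)) (split-at X u Xu X′)) (VP.insertAt-punchIn Z u b j)

⁅⁆-punchIn : ∀ {n} (e : Fin (suc n)) (a : Fin n) → ⁅ punchIn e a ⁆ ≡ insertAt ⁅ a ⁆ e false
⁅⁆-punchIn zero    a       = refl
⁅⁆-punchIn (suc e) zero    = cong (true ∷_) (sym (insertAt-∅ e))
⁅⁆-punchIn (suc e) (suc a) = cong (false ∷_) (⁅⁆-punchIn e a)

⁅⁆-insertAt : ∀ {n} (a : Fin (suc n)) → ⁅ a ⁆ ≡ insertAt ∅ a true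
⁅⁆-insertAt zero            = refl
⁅⁆-insertAt {suc n} (suc a) = cong (false ∷_) (⁅⁆-insertAt a)

fourth : ∀ {k} (a b c : Fin (4 + k)) → ∃ λ d → a ≢ d × b ≢ d × c ≢ d
fourth {k} a b c with FP.any? (λ d → ¬? (a FP.≟ d) ×-dec ¬? (b FP.≟ d) ×-dec ¬? (c FP.≟ d))
... | yes found = found
... | no  none  =
  let (i , j , i<j , same) =
        FP.pigeonhole (s≤s (s≤s (s≤s (s≤s z≤n)))) (λ i → proj₁ (position (i ↑ˡ k)))
  in ⊥-elim (FP.<⇒≢ i<j (FP.↑ˡ-injective k i j (trans (sym (proj₂ (position (i ↑ˡ k))))
                                         (trans (cong (lookup (a ∷ b ∷ c ∷ [])) same)
                                                (proj₂ (position (j ↑ˡ k)))))))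
  where
  -- without a fourth element, every element is one of a, b, c
  position : ∀ d → Σ[ i ∈ Fin 3 ] lookup (a ∷ b ∷ c ∷ []) i ≡ d
  position d with a FP.≟ d | b FP.≟ d | c FP.≟ d
  ... | yes a≡d | _       | _       = zero , a≡d
  ... | no _    | yes b≡d | _       = suc zero , b≡d
  ... | no _    | no _    | yes c≡d = suc (suc zero) , c≡d
  ... | no a≢d  | no b≢d  | no c≢d  = ⊥-elim (none (d , a≢d , b≢d , c≢d))

-- Minors of twisted duals are twisted duals of 3-minors

slice-act : ∀ {n} (M : Vec G (suc n)) e b (T : SetSystem (suc n)) →
  slice e b (act M T) ≗
  lin (ent (lookup M e) b false) (ent (lookup M e) b true)
      (act (removeAt M e) (slice e false T)) (act (removeAt M e) (slice e true T))
slice-act (m ∷ M) zero b T X = refl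
slice-act {suc n} (m ∷ M@(_ ∷ _)) (suc e) b T (x ∷ X) =
  trans (cong₂ (λ p q → (ent m x false ∧ p) xor (ent m x true ∧ q))
               (slice-act M e b (slice zero false T) X) (slice-act M e b (slice zero true T) X))
        (interchange (ent m x false) (ent m x true) (ent (lookup M e) b false) (ent (lookup M e) b true)
                     _ _ _ _)

choose : ∀ {n} → SetSystem n → SetSystem n → SetSystem n
choose f g Y = if nonempty f then f Y else g Y

choose-cong : ∀ {n} {f f′ g g′ : SetSystem n} → f ≗ f′ → (nonempty f′ ≡ false → g ≗ g′) →
  choose f g ≗ choose f′ g′
choose-cong {f = f} {f′} f≗f′ g≗g′ Y rewrite nonempty-cong f≗f′ with nonempty f′
... | true  = f≗f′ Y
... | false = g≗g′ refl Y

-- deleting (b = false) or contracting (b = true) the element e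
minor : ∀ {n} → Fin (suc n) → Bool → SetSystem (suc n) → SetSystem n
minor e b T = choose (slice e b T) (slice e (not b) T)

loopG-singleton-at : ∀ {n} (e : Fin (suc n)) → lookup (map loopG ⁅ e ⁆) e ≡ ℓ
loopG-singleton-at zero          = refl
loopG-singleton-at {suc n} (suc e) = loopG-singleton-at e

loopG-singleton-removeAt : ∀ {n} (e : Fin (suc n)) → removeAt (map loopG ⁅ e ⁆) e ≡ identity n
loopG-singleton-removeAt {n}     zero = loopG-empty n
  where
  loopG-empty : ∀ n → map loopG (∅ {n}) ≡ identity n
  loopG-empty zero    = refl
  loopG-empty (suc n) = cong (ι ∷_) (loopG-empty n)
loopG-singleton-removeAt {suc n} (suc zero)     = cong (ι ∷_) (loopG-singleton-removeAt {n} zero)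
loopG-singleton-removeAt {suc (suc n)} (suc (suc e)) = cong (ι ∷_) (loopG-singleton-removeAt (suc e))

slice-loop-singleton : ∀ {n} (a : Fin (suc n)) b (T : SetSystem (suc n)) →
  slice a b (act (map loopG ⁅ a ⁆) T) ≗
  lin (ent ℓ b false) (ent ℓ b true) (slice a false T) (slice a true T)
slice-loop-singleton a b T Y = trans (slice-act (map loopG ⁅ a ⁆) a b T Y) simplify
  where
  L : Vec G (suc _)
  L = map loopG ⁅ a ⁆
  simplify : lin (ent (lookup L a) b false) (ent (lookup L a) b true)
                 (act (removeAt L a) (slice a false T)) (act (removeAt L a) (slice a true T)) Y ≡
             lin (ent ℓ b false) (ent ℓ b true) (slice a false T) (slice a true T) Y
  simplify rewrite loopG-singleton-at a | loopG-singleton-removeAt a =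
    cong₂ (λ p q → (ent ℓ b false ∧ p) xor (ent ℓ b true ∧ q)) (act-identity _ Y) (act-identity _ Y)

loop-singleton-value : ∀ {n} (a : Fin (suc n)) (T : SetSystem (suc n)) Z → lookup Z a ≡ true →
  act (map loopG ⁅ a ⁆) T Z ≡ T (Z △ ⁅ a ⁆) xor T Z
loop-singleton-value a T Z Za =
  begin
    act (map loopG ⁅ a ⁆) T Z
  ≡⟨ cong (act (map loopG ⁅ a ⁆) T) (sym Z≡) ⟩
    slice a true (act (map loopG ⁅ a ⁆) T) Z′
  ≡⟨ slice-loop-singleton a true T Z′ ⟩
    T (insertAt Z′ a false) xor T (insertAt Z′ a true)
  ≡⟨ cong₂ _xor_ (cong T Z−a≡) (cong T Z≡) ⟩
    T (Z △ ⁅ a ⁆) xor T Z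
  ∎
  where
  open ≡-Reasoning
  Z′ : Subset _
  Z′ = removeAt Z a
  Z≡ : insertAt Z′ a true ≡ Z
  Z≡ = sym (split-at Z a Za refl)
  Z−a≡ : insertAt Z′ a false ≡ Z △ ⁅ a ⁆
  Z−a≡ = sym (begin
    Z △ ⁅ a ⁆                                  ≡⟨ cong₂ _△_ (sym Z≡) (⁅⁆-insertAt a) ⟩
    insertAt Z′ a true △ insertAt ∅ a true     ≡⟨ zipWith-insertAt _xor_ Z′ ∅ a true true ⟩
    insertAt (Z′ △ ∅) a false                  ≡⟨ cong (λ V → insertAt V a false)
                                                        (trans (△-comm Z′ ∅) (∅-△ Z′)) ⟩
    insertAt Z′ a false                        ∎)

module MinorsOfTwistedDuals {n} (S : SetSystem (suc n)) (e : Fin (suc n)) where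

  U₀ U₁ : SetSystem n
  U₀ = slice e false S
  U₁ = slice e true S

  row : G → Bool → SetSystem n
  row g c = lin (ent g c false) (ent g c true) U₀ U₁

  rowMinor : G → Bool → SetSystem n
  rowMinor g b = choose (row g b) (row g (not b))

  slice-twistedDual : ∀ (M : Vec G (suc n)) b → slice e b (act M S) ≗ act (removeAt M e) (row (lookup M e) b)
  slice-twistedDual M b X =
    trans (slice-act M e b S X)
          (sym (act-linear (removeAt M e) (ent (lookup M e) b false) (ent (lookup M e) b true) U₀ U₁ X))

  minor-twistedDual : ∀ (M : Vec G (suc n)) b →
    minor e b (act M S) ≗ act (removeAt M e) (rowMinor (lookup M e) b)
  minor-twistedDual M b X
    rewrite nonempty-cong (slice-twistedDual M b) | nonempty-act (removeAt M e) (row (lookup M e) b)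
    with nonempty (row (lookup M e) b)
  ... | true  = slice-twistedDual M b X
  ... | false = slice-twistedDual M (not b) X

  penrose-choose : penrose e S ≗ choose (lin true true U₀ U₁) U₀
  penrose-choose = choose-cong (slice-loop true) (λ _ Y → trans (slice-loop false Y) (BP.xor-identityʳ _))
    where
    slice-loop : ∀ b → slice e b (loopCompl ⁅ e ⁆ S) ≗ lin (ent ℓ b false) (ent ℓ b true) U₀ U₁
    slice-loop b Y = trans (loopCompl-act ⁅ e ⁆ S (insertAt Y e b)) (slice-loop-singleton e b S Y)

  ThreeMinorOfS : SetSystem n → Set
  ThreeMinorOfS Q = Σ[ Q′ ∈ SetSystem n ] (Q ≗ Q′ × ProperThreeMinor S Q′)

  -- the six ordered pairs (first choice, fallback) of distinct nonzero rows: first choice U₀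
  -- gives the deletion, U₁ the contraction and U₀ + U₁ the Penrose contraction
  is-U₀ : lin true false U₀ U₁ ≗ U₀
  is-U₀ Y = BP.xor-identityʳ _
  by-delete₁ : ThreeMinorOfS (choose (lin true false U₀ U₁) (lin false true U₀ U₁))
  by-delete₁ = delete e S , choose-cong is-U₀ (λ _ _ → refl) , ptm-del e tm-refl
  by-delete₂ : ThreeMinorOfS (choose (lin true false U₀ U₁) (lin true true U₀ U₁))
  by-delete₂ = delete e S ,
               choose-cong is-U₀ (λ U₀-empty Y → cong (_xor U₁ Y) (nonempty-false U₀ U₀-empty Y)) ,
               ptm-del e tm-refl
  by-contract₁ : ThreeMinorOfS (choose (lin false true U₀ U₁) (lin true false U₀ U₁))
  by-contract₁ = contract e S , choose-cong (λ _ → refl) (λ _ → is-U₀) , ptm-con e tm-refl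
  by-contract₂ : ThreeMinorOfS (choose (lin false true U₀ U₁) (lin true true U₀ U₁))
  by-contract₂ = contract e S , choose-cong (λ _ → refl) (λ U₁-empty Y →
    trans (cong (U₀ Y xor_) (nonempty-false U₁ U₁-empty Y)) (BP.xor-identityʳ _)) , ptm-con e tm-refl
  by-penrose₁ : ThreeMinorOfS (choose (lin true true U₀ U₁) (lin true false U₀ U₁))
  by-penrose₁ = penrose e S ,
                (λ Y → trans (choose-cong (λ _ → refl) (λ _ → is-U₀) Y) (sym (penrose-choose Y))) ,
                ptm-pen e tm-refl
  by-penrose₂ : ThreeMinorOfS (choose (lin true true U₀ U₁) (lin false true U₀ U₁))
  by-penrose₂ = penrose e S ,
                (λ Y → trans (choose-cong {g = U₁} {g′ = U₀} (λ _ → refl)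
                                          (λ sum-empty Y → sym (xor-zero (nonempty-false _ sum-empty Y))) Y)
                             (sym (penrose-choose Y))) ,
                ptm-pen e tm-refl
    where
    xor-zero : ∀ {a b} → a xor b ≡ false → a ≡ b
    xor-zero {false} {false} _ = refl
    xor-zero {true}  {true}  _ = refl

  rowMinor-threeMinor : ∀ g b → ThreeMinorOfS (rowMinor g b)
  rowMinor-threeMinor ι   false = by-delete₁
  rowMinor-threeMinor ι   true  = by-contract₁
  rowMinor-threeMinor τ   false = by-contract₁
  rowMinor-threeMinor τ   true  = by-delete₁
  rowMinor-threeMinor ℓ   false = by-delete₂
  rowMinor-threeMinor ℓ   true  = by-penrose₁
  rowMinor-threeMinor ℓτ  false = by-contract₂
  rowMinor-threeMinor ℓτ  true  = by-penrose₂
  rowMinor-threeMinor τℓ  false = by-penrose₁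
  rowMinor-threeMinor τℓ  true  = by-delete₂
  rowMinor-threeMinor τℓτ false = by-penrose₂
  rowMinor-threeMinor τℓτ true  = by-contract₂

DeltaMatroid-≗ : ∀ {n} {T T′ : SetSystem n} → T ≗ T′ → DeltaMatroid T → DeltaMatroid T′
DeltaMatroid-≗ T≗T′ ((X , TX) , exchange) =
  (X , trans (sym (T≗T′ X)) TX) , λ X Y T′X T′Y u u∈ →
    let (v , v∈ , T[X△uv]) = exchange X Y (trans (T≗T′ X) T′X) (trans (T≗T′ Y) T′Y) u u∈
    in v , v∈ , trans (sym (T≗T′ _)) T[X△uv]

vfSafe-act : ∀ {n} {Q : SetSystem n} → VfSafe Q → ∀ M → DeltaMatroid (act M Q)
vfSafe-act {Q = Q} (_ , twistedDuals) M =
  DeltaMatroid-≗ (realise-act M Q) (twistedDuals _ (realise-twistedDual M Q))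

act-vfSafe : ∀ {n} {S : SetSystem n} → (∀ M → DeltaMatroid (act M S)) → VfSafe S
act-vfSafe {n} {S} all-act =
  DeltaMatroid-≗ (act-identity S) (all-act (identity n)) ,
  λ T S→T → let (M , T≗MS) = twistedDual-act S→T in DeltaMatroid-≗ (λ X → sym (T≗MS X)) (all-act M)

proper-act : ∀ {n} {S : SetSystem n} → Proper S → ∀ M → Proper (act M S)
proper-act {S = S} (X , SX) M = nonempty-elim (act M S) (trans (nonempty-act M S) (nonempty-intro S X SX))

any-vector? : ∀ n {P : Vec G n → Set} → (∀ M → Dec (P M)) → Dec (∃ P)
any-vector? zero    P? = map′ ([] ,_) (λ { ([] , p) → p }) (P? [])
any-vector? (suc n) P? =
  map′ (λ (g , M , p) → g ∷ M , p) (λ { (g ∷ M , p) → g , M , p })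
       (EnumG.any? λ g → any-vector? n (λ M → P? (g ∷ M)))

-- Failures of the exchange axiom: they survive in minors, and complementary ones become ∅-E failures

ExchangeFailure : ∀ {n} → SetSystem n → Subset n → Subset n → Fin n → Set
ExchangeFailure T X Y u = T X ≡ true × T Y ≡ true × u ∈ˢ (X △ Y) ×
  (∀ v → v ∈ˢ (X △ Y) → T (X △ (⁅ u ⁆ ∪ ⁅ v ⁆)) ≡ false)

exchange-insertAt : ∀ {n} (X : Subset n) e b (u v : Fin n) →
  insertAt X e b △ (⁅ punchIn e u ⁆ ∪ ⁅ punchIn e v ⁆) ≡ insertAt (X △ (⁅ u ⁆ ∪ ⁅ v ⁆)) e b
exchange-insertAt X e b u v =
  begin
    insertAt X e b △ (⁅ punchIn e u ⁆ ∪ ⁅ punchIn e v ⁆)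
  ≡⟨ cong₂ (λ p q → insertAt X e b △ (p ∪ q)) (⁅⁆-punchIn e u) (⁅⁆-punchIn e v) ⟩
    insertAt X e b △ (insertAt ⁅ u ⁆ e false ∪ insertAt ⁅ v ⁆ e false)
  ≡⟨ cong (insertAt X e b △_) (zipWith-insertAt _∨_ ⁅ u ⁆ ⁅ v ⁆ e false false) ⟩
    insertAt X e b △ insertAt (⁅ u ⁆ ∪ ⁅ v ⁆) e false
  ≡⟨ zipWith-insertAt _xor_ X (⁅ u ⁆ ∪ ⁅ v ⁆) e b false ⟩
    insertAt (X △ (⁅ u ⁆ ∪ ⁅ v ⁆)) e (b xor false)
  ≡⟨ cong (insertAt (X △ (⁅ u ⁆ ∪ ⁅ v ⁆)) e) (BP.xor-identityʳ b) ⟩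
    insertAt (X △ (⁅ u ⁆ ∪ ⁅ v ⁆)) e b
  ∎
  where open ≡-Reasoning

lookup-insertAt-△ : ∀ {n} (X Y : Subset n) e b (j : Fin n) →
  lookup (insertAt X e b △ insertAt Y e b) (punchIn e j) ≡ lookup (X △ Y) j
lookup-insertAt-△ X Y e b j =
  trans (cong (λ V → lookup V (punchIn e j)) (zipWith-insertAt _xor_ X Y e b b))
        (VP.insertAt-punchIn (X △ Y) e (b xor b) j)

minor-slice : ∀ {n} e b (T : SetSystem (suc n)) → nonempty (slice e b T) ≡ true → minor e b T ≗ slice e b T
minor-slice e b T ne Z rewrite ne = refl

failure-minor-insertAt : ∀ {n} (T : SetSystem (suc n)) (X Y : Subset n) e b (u : Fin n) →
  ExchangeFailure T (insertAt X e b) (insertAt Y e b) (punchIn e u) → ¬ DeltaMatroid (minor e b T)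
failure-minor-insertAt T X Y e b u (TX , TY , u∈ , no-v) (_ , exchange) =
  let (v , v∈ , feasible) = exchange X Y (trans (minor-slice e b T ne X) TX) (trans (minor-slice e b T ne Y) TY) u
                              (unlift∈ u u∈)
  in true≢false (begin
      true                                                   ≡⟨ sym feasible ⟩
      minor e b T (X △ (⁅ u ⁆ ∪ ⁅ v ⁆))                       ≡⟨ minor-slice e b T ne _ ⟩
      T (insertAt (X △ (⁅ u ⁆ ∪ ⁅ v ⁆)) e b)
        ≡⟨ cong T (sym (exchange-insertAt X e b u v)) ⟩
      T (insertAt X e b △ (⁅ punchIn e u ⁆ ∪ ⁅ punchIn e v ⁆))
        ≡⟨ no-v (punchIn e v) (lift∈ v v∈) ⟩
      false                                                  ∎)
  where
  open ≡-Reasoning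
  ne : nonempty (slice e b T) ≡ true
  ne = nonempty-intro (slice e b T) X TX
  lift∈ : ∀ v → v ∈ˢ (X △ Y) → punchIn e v ∈ˢ (insertAt X e b △ insertAt Y e b)
  lift∈ v v∈ = lookup⇒∈ (trans (lookup-insertAt-△ X Y e b v) (∈⇒lookup v∈))
  unlift∈ : ∀ v → punchIn e v ∈ˢ (insertAt X e b △ insertAt Y e b) → v ∈ˢ (X △ Y)
  unlift∈ v v∈ = lookup⇒∈ (trans (sym (lookup-insertAt-△ X Y e b v)) (∈⇒lookup v∈))

failure-minor : ∀ {n} (T : SetSystem (suc n)) (X Y : Subset (suc n)) u e → lookup X e ≡ lookup Y e →
  ExchangeFailure T X Y u → ¬ DeltaMatroid (minor e (lookup X e) T)
failure-minor T X Y u e agree failure =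
  failure-minor-insertAt T (removeAt X e) (removeAt Y e) e (lookup X e) (punchOut e≢u) failure′
  where
  e≢u : e ≢ u
  e≢u refl = true≢false (begin
    true                      ≡⟨ sym (∈⇒lookup (proj₁ (proj₂ (proj₂ failure)))) ⟩
    lookup (X △ Y) e          ≡⟨ lookup-△ X Y e ⟩
    lookup X e xor lookup Y e ≡⟨ cong (lookup X e xor_) (sym agree) ⟩
    lookup X e xor lookup X e ≡⟨ BP.xor-same (lookup X e) ⟩
    false                     ∎)
    where open ≡-Reasoning
  X′ : insertAt (removeAt X e) e (lookup X e) ≡ X
  X′ = VP.insertAt-removeAt X e
  Y′ : insertAt (removeAt Y e) e (lookup X e) ≡ Y
  Y′ = trans (cong (insertAt (removeAt Y e) e) agree) (VP.insertAt-removeAt Y e)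
  failure′ : ExchangeFailure T (insertAt (removeAt X e) e (lookup X e)) (insertAt (removeAt Y e) e (lookup X e))
                              (punchIn e (punchOut e≢u))
  failure′ rewrite X′ | Y′ | FP.punchIn-punchOut e≢u = failure

-- the exchange axiom fails for ∅, E and u in T (every v lies in ∅ △ E)
EmptyFullFailure : ∀ {n} → SetSystem n → Fin n → Set
EmptyFullFailure T u = T ∅ ≡ true × T E ≡ true × (∀ v → T (⁅ u ⁆ ∪ ⁅ v ⁆) ≡ false)

emptyFullFailure? : ∀ {n} (T : SetSystem n) u → Dec (EmptyFullFailure T u)
emptyFullFailure? T u =
  (T ∅ BP.≟ true) ×-dec (T E BP.≟ true) ×-dec FP.all? (λ v → T (⁅ u ⁆ ∪ ⁅ v ⁆) BP.≟ false)

complementary-failure : ∀ {n} (T : SetSystem n) X Y u → (∀ e → lookup X e ≢ lookup Y e) →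
  ExchangeFailure T X Y u → EmptyFullFailure (twist X T) u
complementary-failure T X Y u apart (TX , TY , _ , no-v) =
  trans (cong T (∅-△ X)) TX ,
  trans (cong T (subset-ext (E △ X) Y λ i →
           trans (lookup-△ E X i) (trans (cong (_xor lookup X i) (lookup-E i)) (sym (Y-opposite i))))) TY ,
  λ v → trans (cong T (△-comm _ X)) (no-v v (lookup⇒∈ (begin
          lookup (X △ Y) v               ≡⟨ lookup-△ X Y v ⟩
          lookup X v xor lookup Y v       ≡⟨ cong (lookup X v xor_) (Y-opposite v) ⟩
          lookup X v xor not (lookup X v) ≡⟨ BP.xor-inverseʳ (lookup X v) ⟩
          true                            ∎)))
  where
  open ≡-Reasoning
  Y-opposite : ∀ i → lookup Y i ≡ not (lookup X i)
  Y-opposite i = BP.¬-not (apart i ∘ sym)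

Pinned : ∀ {n} → SetSystem n → Fin n → Set
Pinned T u =
  T ∅ ≡ true × T E ≡ true × (∀ Z d → lookup Z u ≡ true → lookup Z d ≡ false → T Z ≡ false)

module MinorsSafe {n} (S : SetSystem (suc n))
                  (minorsSafe : ∀ {m} (T : SetSystem m) → ProperThreeMinor S T → VfSafe T) where

  minor-deltaMatroid : ∀ M e b → DeltaMatroid (minor e b (act M S))
  minor-deltaMatroid M e b =
    let (Q , row≗Q , S→Q) = rowMinor-threeMinor (lookup M e) b
    in DeltaMatroid-≗ (λ X → sym (trans (minor-twistedDual M b X) (act-cong (removeAt M e) row≗Q X)))
                      (vfSafe-act (minorsSafe Q S→Q) (removeAt M e))
    where open MinorsOfTwistedDuals S e

  no-agreeing-failure : ∀ M X Y u e → lookup X e ≡ lookup Y e → ¬ ExchangeFailure (act M S) X Y u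
  no-agreeing-failure M X Y u e agree failure =
    failure-minor (act M S) X Y u e agree failure (minor-deltaMatroid M e (lookup X e))

  -- after an ∅-E failure at u, no set Z ∋ u other than E is feasible: otherwise ∅, Z and u
  -- would be a failure of sets agreeing outside Z
  failure-pinned : ∀ M u → EmptyFullFailure (act M S) u → Pinned (act M S) u
  failure-pinned M u (T∅ , TE , no-pair) = T∅ , TE , infeasible
    where
    infeasible : ∀ Z d → lookup Z u ≡ true → lookup Z d ≡ false → act M S Z ≡ false
    infeasible Z d Zu Zd with act M S Z in TZ
    ... | false = refl
    ... | true  = ⊥-elim (no-agreeing-failure M ∅ Z u d (trans (lookup-∅ d) (sym Zd))
                    (T∅ , TZ , lookup⇒∈ (trans (lookup-△ ∅ Z u) (cong₂ _xor_ (lookup-∅ u) Zu)) ,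
                     λ v _ → trans (cong (act M S) (∅-△ _)) (no-pair v)))

  failure-normal-form : ∀ M X Y u → ExchangeFailure (act M S) X Y u →
    Σ[ M′ ∈ Vec G (suc n) ] EmptyFullFailure (act M′ S) u
  failure-normal-form M X Y u failure with FP.any? (λ e → lookup X e BP.≟ lookup Y e)
  ... | yes (e , agree) = ⊥-elim (no-agreeing-failure M X Y u e agree failure)
  ... | no  apart       =
    let (T∅ , TE , no-pair) = complementary-failure (act M S) X Y u (λ e agree → apart (e , agree)) failure
        twisted≗ : twist X (act M S) ≗ act (zipWith _·_ (map twistG X) M) S
        twisted≗ = λ Z → trans (twist-act X (act M S) Z) (act-∘ (map twistG X) M S Z)
    in zipWith _·_ (map twistG X) M ,
       trans (sym (twisted≗ ∅)) T∅ , trans (sym (twisted≗ E)) TE ,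
       λ v → trans (sym (twisted≗ _)) (no-pair v)

  safe-or-failure : Proper S → VfSafe S ⊎ (Σ[ M ∈ Vec G (suc n) ] ∃ (EmptyFullFailure (act M S)))
  safe-or-failure proper with any-vector? (suc n) (λ M → FP.any? (λ u → emptyFullFailure? (act M S) u))
  ... | yes found = inj₂ found
  ... | no  none  = inj₁ (act-vfSafe λ M → proper-act proper M , exchange M)
    where
    exchange : ∀ M X Y → act M S X ≡ true → act M S Y ≡ true → ∀ u → u ∈ˢ (X △ Y) →
      Σ[ v ∈ Fin (suc n) ] (v ∈ˢ (X △ Y) × act M S (X △ (⁅ u ⁆ ∪ ⁅ v ⁆)) ≡ true)
    exchange M X Y TX TY u u∈
      with FP.any? (λ v → (v SP.∈? (X △ Y)) ×-dec (act M S (X △ (⁅ u ⁆ ∪ ⁅ v ⁆)) BP.≟ true))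
    ... | yes found   = found
    ... | no  missing =
      let no-v = λ v v∈ → BP.¬-not (λ feasible → missing (v , v∈ , feasible))
          (M′ , failure) = failure-normal-form M X Y u (TX , TY , u∈ , no-v)
      in ⊥-elim (none (M′ , u , failure))

  -- On a ground set with more than three elements, an ∅-E failure at u in T = act M S
  -- moves, by loop complementing some a ≠ u, to a failure at {a}, E and u.
  module LargeGroundSet (fresh : ∀ (a b c : Fin (suc n)) → ∃ λ d → a ≢ d × b ≢ d × c ≢ d)
                        (M : Vec G (suc n)) (u : Fin (suc n)) (failure : EmptyFullFailure (act M S) u) where

    T : SetSystem (suc n)
    T = act M S

    a : Fin (suc n)
    a = proj₁ (fresh u u u)

    u≢a : u ≢ a
    u≢a = proj₁ (proj₂ (fresh u u u))

    T∅ : T ∅ ≡ true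
    T∅ = proj₁ failure

    TE : T E ≡ true
    TE = proj₁ (proj₂ failure)

    infeasible : ∀ Z d → lookup Z u ≡ true → lookup Z d ≡ false → T Z ≡ false
    infeasible = proj₂ (proj₂ (failure-pinned M u failure))

    u∈⁅a⁆△E : u ∈ˢ (⁅ a ⁆ △ E)
    u∈⁅a⁆△E =
      lookup⇒∈ (trans (lookup-△ ⁅ a ⁆ E u) (cong₂ _xor_ (lookup-⁅⁆-≢ (u≢a ∘ sym)) (lookup-E u)))

    lookup-W : ∀ v i →
      lookup (⁅ a ⁆ △ (⁅ u ⁆ ∪ ⁅ v ⁆)) i ≡ lookup ⁅ a ⁆ i xor (lookup ⁅ u ⁆ i ∨ lookup ⁅ v ⁆ i)
    lookup-W v i =
      trans (lookup-△ ⁅ a ⁆ _ i) (cong (lookup ⁅ a ⁆ i xor_) (lookup-∪ ⁅ u ⁆ ⁅ v ⁆ i))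

    -- {a} △ {u, v} contains u but misses a fourth element
    pair-infeasible : ∀ v → T (⁅ a ⁆ △ (⁅ u ⁆ ∪ ⁅ v ⁆)) ≡ false
    pair-infeasible v =
      let (d , a≢d , u≢d , v≢d) = fresh a u v in
      infeasible _ d
        (trans (lookup-W v u) (cong₂ (λ p q → p xor (q ∨ lookup ⁅ v ⁆ u))
                                     (lookup-⁅⁆-≢ (u≢a ∘ sym)) (lookup-⁅⁆-≡ u)))
        (trans (lookup-W v d) (cong₂ _xor_ (lookup-⁅⁆-≢ a≢d)
                                           (cong₂ _∨_ (lookup-⁅⁆-≢ u≢d) (lookup-⁅⁆-≢ v≢d))))

    -- {a} is infeasible, for otherwise {a}, E and u would fail in T
    singleton-infeasible : T ⁅ a ⁆ ≡ false
    singleton-infeasible with T ⁅ a ⁆ in feasible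
    ... | false = refl
    ... | true  = ⊥-elim (no-agreeing-failure M ⁅ a ⁆ E u a (trans (lookup-⁅⁆-≡ a) (sym (lookup-E a)))
                           (feasible , TE , u∈⁅a⁆△E , λ v _ → pair-infeasible v))

    M′ : Vec G (suc n)
    M′ = zipWith _·_ (map loopG ⁅ a ⁆) M

    loop-value : ∀ Z → lookup Z a ≡ true → act M′ S Z ≡ T (Z △ ⁅ a ⁆) xor T Z
    loop-value Z Za = trans (sym (act-∘ (map loopG ⁅ a ⁆) M S Z)) (loop-singleton-value a T Z Za)

    loop-failure : ExchangeFailure (act M′ S) ⁅ a ⁆ E u
    loop-failure =
      trans (loop-value ⁅ a ⁆ (lookup-⁅⁆-≡ a))
            (cong₂ _xor_ (trans (cong T (△-self ⁅ a ⁆)) T∅) singleton-infeasible) ,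
      trans (loop-value E (lookup-E a)) (cong₂ _xor_ TE−a TE) ,
      u∈⁅a⁆△E ,
      λ v v∈ → trans (loop-value _ (W∋a v v∈))
                     (cong₂ _xor_ (trans (cong T (△-cancel ⁅ a ⁆ _)) (proj₂ (proj₂ failure) v))
                                  (pair-infeasible v))
      where
      TE−a : T (E △ ⁅ a ⁆) ≡ false
      TE−a = infeasible (E △ ⁅ a ⁆) a
        (trans (lookup-△ E ⁅ a ⁆ u) (cong₂ _xor_ (lookup-E u) (lookup-⁅⁆-≢ (u≢a ∘ sym))))
        (trans (lookup-△ E ⁅ a ⁆ a) (cong₂ _xor_ (lookup-E a) (lookup-⁅⁆-≡ a)))
      W∋a : ∀ v → v ∈ˢ (⁅ a ⁆ △ E) → lookup (⁅ a ⁆ △ (⁅ u ⁆ ∪ ⁅ v ⁆)) a ≡ true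
      W∋a v v∈ = trans (lookup-W v a) (cong₂ _xor_ (lookup-⁅⁆-≡ a)
                                             (cong₂ _∨_ (lookup-⁅⁆-≢ u≢a) (lookup-⁅⁆-≢ v≢a)))
        where
        v≢a : v ≢ a
        v≢a refl = true≢false (trans (sym (∈⇒lookup v∈))
                     (trans (lookup-△ ⁅ a ⁆ E a) (cong₂ _xor_ (lookup-⁅⁆-≡ a) (lookup-E a))))

  no-failure-large : (∀ (a b c : Fin (suc n)) → ∃ λ d → a ≢ d × b ≢ d × c ≢ d) →
    ∀ M u → ¬ EmptyFullFailure (act M S) u
  no-failure-large fresh M u failure =
    no-agreeing-failure M′ ⁅ a ⁆ E u a (trans (lookup-⁅⁆-≡ a) (sym (lookup-E a))) loop-failure
    where open LargeGroundSet fresh M u failure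

-- Three elements: the pinned systems are, up to isomorphism, twists of S₃ or T₁, …, T₄

-- the three-element system pinned at u in which the sets {v}, {w}, {v, w}
-- avoiding u (where v < w) have feasibility p, q, r
pinned3 : Fin 3 → Bool → Bool → Bool → SetSystem 3
pinned3 u p q r X with lookup X u | removeAt X u
... | false | false ∷ false ∷ [] = true
... | false | true  ∷ false ∷ [] = p
... | false | false ∷ true  ∷ [] = q
... | false | true  ∷ true  ∷ [] = r
... | true  | true  ∷ true  ∷ [] = true
... | true  | false ∷ false ∷ [] = false
... | true  | true  ∷ false ∷ [] = false
... | true  | false ∷ true  ∷ [] = false

pinned3-normal : ∀ (T : SetSystem 3) u → Pinned T u →
  T ≗ pinned3 u (T (insertAt (true ∷ false ∷ []) u false)) (T (insertAt (false ∷ true ∷ []) u false))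
                (T (insertAt (true ∷ true ∷ []) u false))
pinned3-normal T u (T∅ , TE , infeasible) X with lookup X u in Xu | removeAt X u in X′
... | false | false ∷ false ∷ [] = trans (cong T (trans (split-at X u Xu X′) (insertAt-∅ u))) T∅
... | false | true  ∷ false ∷ [] = cong T (split-at X u Xu X′)
... | false | false ∷ true  ∷ [] = cong T (split-at X u Xu X′)
... | false | true  ∷ true  ∷ [] = cong T (split-at X u Xu X′)
... | true  | true  ∷ true  ∷ [] = trans (cong T (trans (split-at X u Xu X′) (insertAt-E u))) TE
... | true  | false ∷ false ∷ [] = infeasible X (punchIn u zero) Xu (lookup-punchIn X u Xu X′ zero)
... | true  | true  ∷ false ∷ [] = infeasible X (punchIn u (suc zero)) Xu (lookup-punchIn X u Xu X′ (suc zero))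
... | true  | false ∷ true  ∷ [] = infeasible X (punchIn u zero) Xu (lookup-punchIn X u Xu X′ zero)

data Shape : Set where
  S₃ T₁′ T₂′ T₃′ T₄′ : Shape

shapeSystem : Shape → SetSystem 3
shapeSystem S₃  = Sfam 3
shapeSystem T₁′ = T₁
shapeSystem T₂′ = T₂
shapeSystem T₃′ = T₃
shapeSystem T₄′ = T₄

permutations : List (Permutation 3 3)
permutations = id ∷ t₀₁ ∷ t₀₂ ∷ t₁₂ ∷ (t₀₁ ∘ₚ t₀₂) ∷ (t₀₂ ∘ₚ t₀₁) ∷ []
  where
  t₀₁ t₀₂ t₁₂ : Permutation 3 3
  t₀₁ = transpose zero (suc zero)
  t₀₂ = transpose zero (suc (suc zero))
  t₁₂ = transpose (suc zero) (suc (suc zero))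

Candidate : Set
Candidate = Shape × Subset 3 × Permutation 3 3

candidates : List Candidate
candidates = concatMap (λ s → concatMap (λ A → mapᴸ (λ σ → s , A , σ) permutations) (allSubsets 3))
                       (S₃ ∷ T₁′ ∷ T₂′ ∷ T₃′ ∷ T₄′ ∷ [])

Realises : SetSystem 3 → Candidate → Set
Realises f (s , A , σ) = ∀ X → twist A (shapeSystem s) (image σ X) ≡ f X

realises? : ∀ f c → Dec (Realises f c)
realises? f (s , A , σ) = EnumSubset.all? λ X → twist A (shapeSystem s) (image σ X) BP.≟ f X

realised-family : ∀ f c → Realises f c → IsoToFamS f ⊎ IsoToFamT f
realised-family f (S₃  , A , σ) iso = inj₁ (3 , s≤s (s≤s (s≤s z≤n)) , A , σ , iso)
realised-family f (T₁′ , A , σ) iso = inj₂ (inj₁ (A , inj₁ (σ , iso)))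
realised-family f (T₂′ , A , σ) iso = inj₂ (inj₁ (A , inj₂ (inj₁ (σ , iso))))
realised-family f (T₃′ , A , σ) iso = inj₂ (inj₁ (A , inj₂ (inj₂ (inj₁ (σ , iso)))))
realised-family f (T₄′ , A , σ) iso = inj₂ (inj₁ (A , inj₂ (inj₂ (inj₂ (σ , iso)))))

pinned3-realised : ∀ u p q r → Any (Realises (pinned3 u p q r)) candidates
pinned3-realised =
  toWitness {a? = FP.all? λ u → EnumBool.all? λ p → EnumBool.all? λ q → EnumBool.all? λ r →
                    Any.any? (realises? (pinned3 u p q r)) candidates} _

pinned-three-elements : ∀ (T : SetSystem 3) u → Pinned T u → IsoToFamS T ⊎ IsoToFamT T
pinned-three-elements T u pinned =
  let (c , realises) = satisfied (pinned3-realised u _ _ _)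
  in realised-family T c (λ X → trans (realises X) (sym (pinned3-normal T u pinned X)))

-- an ∅-E failure in a twisted dual of an excluded 3-minor: impossible on at most two
-- elements (E = {u, v} for some v) and on at least four, and on three elements the
-- twisted dual is pinned, hence isomorphic to a member of 𝒮 ∪ 𝒯
failure-classification : ∀ n (S : SetSystem (suc n)) →
  (∀ {m} (T : SetSystem m) → ProperThreeMinor S T → VfSafe T) →
  ∀ M u → EmptyFullFailure (act M S) u → IsoToFamS (realise M S) ⊎ IsoToFamT (realise M S)
failure-classification 0 S _ M zero (_ , TE , no-pair) = ⊥-elim (true≢false (trans (sym TE) (no-pair zero)))
failure-classification 1 S _ M zero (_ , TE , no-pair) = ⊥-elim (true≢false (trans (sym TE) (no-pair (suc zero))))
failure-classification 1 S _ M (suc zero) (_ , TE , no-pair) = ⊥-elim (true≢false (trans (sym TE) (no-pair zero)))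
failure-classification 2 S minorsSafe M u failure =
  let (T∅ , TE , infeasible) = MinorsSafe.failure-pinned S minorsSafe M u failure
      realise≗ : realise M S ≗ act M S
      realise≗ = realise-act M S
  in pinned-three-elements (realise M S) u
       (trans (realise≗ ∅) T∅ , trans (realise≗ E) TE ,
        λ Z d Zu Zd → trans (realise≗ Z) (infeasible Z d Zu Zd))
failure-classification (suc (suc (suc k))) S minorsSafe M u failure =
  ⊥-elim (MinorsSafe.no-failure-large S minorsSafe fourth M u failure)

-- S is not vf-safe, so some twisted dual has an ∅-E failure (on the empty ground set
-- every proper system is vf-safe)
lemma4p3 : ∀ {n} (S : SetSystem n) → ExcludedThreeMinor S →
    Σ[ S′ ∈ SetSystem n ] (TwistedDual S S′ × (IsoToFamS S′ ⊎ IsoToFamT S′))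
lemma4p3 {zero} S (proper , unsafe) =
  ⊥-elim (unsafe (act-vfSafe λ M → proper-act proper M , λ _ _ _ _ ()))
lemma4p3 {suc n} S (proper , unsafe , minorsSafe) with MinorsSafe.safe-or-failure S minorsSafe proper
... | inj₁ safe              = ⊥-elim (unsafe safe)
... | inj₂ (M , u , failure) =
  realise M S , realise-twistedDual M S , failure-classification n S minorsSafe M u failure
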